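{- For every $d\in\mathbb N$ there are infinitely many $n\in\mathbb N$ such that \[ H_{\mathrm{s}}(n,d)\ \ge\ \frac{n^{d-1}}{(d+2)^{d-1}}-3 . \]
   Context: A pure simplicial complex of dimension $d-1$ (a $(d-1)$-complex) on a vertex set $V$ is a family $C$ of $d$-element subsets of $V$, called facets; it has $n$ vertices when $|V|=n$. A ridge is a $(d-1)$-element subset of a facet. The dual (adjacency) graph $G(C)$ has the facets of $C$ as vertices, with $X,Y$ adjacent iff $|X\cap Y|=d-1$ (they share a ridge). $C$ is strongly connected if $G(C)$ is connected, and the (combinatorial) diameter of $C$ is the graph diameter of $G(C)$. $H_{\mathrm{s}}(n,d)$ denotes the maximum diameter of a strongly connected pure $(d-1)$-complex with $n$ vertices. -}

module Defs where

open import Data.Nat using (ℕ; zero; suc; _≤_; _∸_)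
open import Data.Fin.Subset using (Subset; _∩_; ∣_∣)
open import Data.List using (List)
open import Data.List.Membership.Propositional using (_∈_)
open import Data.List.Relation.Unary.All using (All)
open import Relation.Binary.PropositionalEquality using (_≡_)
open import Data.Product using (Σ; _×_; ∃; ∃-syntax)

-- A (candidate) complex on the vertex set Fin n: a finite family of subsets
-- (facets).  Duplicates in the list are irrelevant: everything below only
-- uses membership.
Complex : ℕ → Set
Complex n = List (Subset n)

-- Pure (d-1)-complex: every facet has exactly d elements.
IsPure : ∀ {n} → ℕ → Complex n → Set
IsPure d C = All (λ X → ∣ X ∣ ≡ d) C

Adjacent : ∀ {n} → ℕ → Subset n → Subset n → Set
Adjacent d X Y = ∣ X ∩ Y ∣ ≡ d ∸ 1

data Walk {n : ℕ} (d : ℕ) (C : Complex n) : Subset n → Subset n → ℕ → Set where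
  here : ∀ {X} → X ∈ C → Walk d C X X 0
  step : ∀ {X Y Z m} → X ∈ C → Adjacent d X Y → Walk d C Y Z m →
         Walk d C X Z (suc m)

Dist : ∀ {n} → ℕ → Complex n → Subset n → Subset n → ℕ → Set
Dist d C X Y m = Walk d C X Y m × (∀ k → Walk d C X Y k → m ≤ k)

StronglyConnected : ∀ {n} → ℕ → Complex n → Set
StronglyConnected d C = ∀ X Y → X ∈ C → Y ∈ C → ∃[ m ] Walk d C X Y m

Diameter : ∀ {n} → ℕ → Complex n → ℕ → Set
Diameter d C D =
  (∀ X Y → X ∈ C → Y ∈ C → ∃[ m ] (Walk d C X Y m × m ≤ D)) ×
  (∃[ X ] ∃[ Y ] (X ∈ C × Y ∈ C × Dist d C X Y D))

module Submission where

-- A necklace is a cyclic sequence of q ≥ 3 columns, each an induced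
-- path of facets in the dual graph, where the last facet of column c and the first facet of column
-- c + 1 (mod q) share a ridge and facets of different columns share at most a ridge.  To go up one
-- dimension, build q copies s < q: copy s runs through the columns 0, …, q − 1 in turn, coning each
-- facet of column c with a new vertex labelled c − s (mod q) and passing from column c to c + 1
-- through their common ridge coned with both labels.  Because the labels form a Latin square, each
-- copy is again an induced path and distinct copies share at most a ridge, so the copies form a
-- necklace one dimension higher on q more vertices, with columns about q times longer.  Starting
-- from zigzag paths of edges on 4q vertices, d − 2 steps give an induced path of at least q^(d−1)
-- facets on (d + 2)q vertices, and an induced path of L facets has diameter L − 1.

open import Defs
open import Data.Bool using (true; false)
open import Data.Empty using (⊥-elim)
open import Data.List using ([]; _∷_; applyUpTo)
open import Data.List.Relation.Unary.Any using (here)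
open import Data.List.Relation.Unary.All using ([]; _∷_)
open import Data.List.Membership.Propositional using (_∈_)
open import Data.List.Membership.Propositional.Properties using (∈-applyUpTo⁺; ∈-applyUpTo⁻)
import Data.List.Relation.Unary.All as All
open import Data.Fin.Subset using (Subset; _∩_; _∪_; ∣_∣; ⊥)
open import Data.Fin.Subset.Properties
  using (∩-comm; ∩-idem; ∩-zeroˡ; ∩-distribˡ-∪; ∩-distribʳ-∪; ∣⊥∣≡0; ∣p∩q∣≤∣p∣; ∣p∩q∣≤∣q∣; ∣p∣≤∣p∪q∣; ∣q∣≤∣p∪q∣)
open import Data.Nat
open import Data.Nat.DivMod
open import Data.Nat.Divisibility using (n∣m*n)
open import Data.Nat.Properties
open import Data.Product using (_×_; _,_; proj₁; proj₂; ∃; ∃-syntax)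
open import Data.Nat.Tactic.RingSolver using (solve-∀)
open import Data.Sum using (_⊎_; inj₁; inj₂)
open import Data.Vec using ([]; _∷_; _++_)
open import Data.Vec.Properties using (zipWith-++)
open import Relation.Binary.PropositionalEquality
open import Relation.Binary using (tri<; tri≈; tri>)
open import Relation.Nullary using (¬_; Dec; yes; no)
open import Function using (_∘_; case_of_)

%-injective-window : ∀ q .{{_ : NonZero q}} {x y} → x % q ≡ y % q → x ≤ y → y < x + q → x ≡ y
%-injective-window q {x} {y} x≡y x≤y y<x+q = ≤-antisym x≤y y≤x
  where
  r = x % q
  x≡ : x ≡ r + x / q * q
  x≡ = m≡m%n+[m/n]*n x q
  y≡ : y ≡ r + y / q * q
  y≡ = trans (m≡m%n+[m/n]*n y q) (cong (_+ y / q * q) (sym x≡y))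
  x+q≡ : x + q ≡ r + suc (x / q) * q
  x+q≡ = begin
    x + q                  ≡⟨ cong (_+ q) x≡ ⟩
    r + x / q * q + q      ≡⟨ +-assoc r _ q ⟩
    r + (x / q * q + q)    ≡⟨ cong (r +_) (+-comm _ q) ⟩
    r + suc (x / q) * q    ∎
    where open ≡-Reasoning
  y/q≤x/q : y / q ≤ x / q
  y/q≤x/q = ≤-pred (*-cancelʳ-< q _ _ (+-cancelˡ-< r _ _ (subst₂ _<_ y≡ x+q≡ y<x+q)))
  y≤x : y ≤ x
  y≤x = subst₂ _≤_ (sym y≡) (sym x≡) (+-monoʳ-≤ r (*-monoˡ-≤ q y/q≤x/q))

+-%-cancelˡ-≤ : ∀ q .{{_ : NonZero q}} x {t t'} → (x + t) % q ≡ (x + t') % q → t ≤ t' → t' < q → t ≡ t'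
+-%-cancelˡ-≤ q x {t} {t'} eq t≤t' t'<q = +-cancelˡ-≡ x t t'
  (%-injective-window q eq (+-monoʳ-≤ x t≤t') (≤-trans (+-monoʳ-< x t'<q) (+-monoˡ-≤ q (m≤m+n x t))))

+-%-cancelˡ : ∀ q .{{_ : NonZero q}} x {t t'} → (x + t) % q ≡ (x + t') % q → t < q → t' < q → t ≡ t'
+-%-cancelˡ q x {t} {t'} eq t<q t'<q with ≤-total t t'
... | inj₁ t≤t' = +-%-cancelˡ-≤ q x eq t≤t' t'<q
... | inj₂ t'≤t = sym (+-%-cancelˡ-≤ q x (sym eq) t'≤t t<q)

%-congˡ-+ : ∀ q .{{_ : NonZero q}} {a b} t → a % q ≡ b % q → (a + t) % q ≡ (b + t) % q
%-congˡ-+ q {a} {b} t eq = trans (%-distribˡ-+ a t q) (trans (cong (λ z → (z + t % q) % q) eq) (sym (%-distribˡ-+ b t q)))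

m∸n≡1+[m∸1+n] : ∀ {m n} → n < m → m ∸ n ≡ suc (m ∸ suc n)
m∸n≡1+[m∸1+n] {suc m} {zero} _ = refl
m∸n≡1+[m∸1+n] {suc m} {suc n} (s≤s n<m) = m∸n≡1+[m∸1+n] n<m

⌊1+n/2⌋≡⌊n/2⌋⊎1+⌊n/2⌋ : ∀ n → ⌊ suc n /2⌋ ≡ ⌊ n /2⌋ ⊎ ⌊ suc n /2⌋ ≡ suc ⌊ n /2⌋
⌊1+n/2⌋≡⌊n/2⌋⊎1+⌊n/2⌋ zero          = inj₁ refl
⌊1+n/2⌋≡⌊n/2⌋⊎1+⌊n/2⌋ (suc zero)    = inj₂ refl
⌊1+n/2⌋≡⌊n/2⌋⊎1+⌊n/2⌋ (suc (suc n)) with ⌊1+n/2⌋≡⌊n/2⌋⊎1+⌊n/2⌋ n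
... | inj₁ eq = inj₁ (cong suc eq)
... | inj₂ eq = inj₂ (cong suc eq)

n<m+m⇒⌊1+n/2⌋≤m : ∀ {n m} → n < m + m → ⌊ suc n /2⌋ ≤ m
n<m+m⇒⌊1+n/2⌋≤m {m = m} n<m+m = ≤-trans (⌊n/2⌋-mono n<m+m) (≤-reflexive (sym (n≡⌊n+n/2⌋ m)))

n<m+m⇒⌊n/2⌋<m : ∀ {n m} → n < m + m → ⌊ n /2⌋ < m
n<m+m⇒⌊n/2⌋<m {m = m} n<m+m = ≤-trans (⌊n/2⌋-mono (s≤s n<m+m)) (≤-reflexive (sym (n≡⌈n+n/2⌉ m)))

⌊n+n+b/2⌋≡n : ∀ n {b} → b ≤ 1 → ⌊ n + n + b /2⌋ ≡ n
⌊n+n+b/2⌋≡n n z≤n       = trans (cong ⌊_/2⌋ (+-identityʳ (n + n))) (sym (n≡⌊n+n/2⌋ n))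
⌊n+n+b/2⌋≡n n (s≤s z≤n) = trans (cong ⌊_/2⌋ (+-comm (n + n) 1)) (sym (n≡⌈n+n/2⌉ n))

[m*n]^k≡m^k*n^k : ∀ m n k → (m * n) ^ k ≡ m ^ k * n ^ k
[m*n]^k≡m^k*n^k m n zero    = refl
[m*n]^k≡m^k*n^k m n (suc k) = trans (cong (m * n *_) ([m*n]^k≡m^k*n^k m n k)) (interchange m n (m ^ k) (n ^ k))
  where
  interchange : ∀ a b x y → a * b * (x * y) ≡ a * x * (b * y)
  interchange = solve-∀

∣++∣ : ∀ {a b} (p : Subset a) (q : Subset b) → ∣ p ++ q ∣ ≡ ∣ p ∣ + ∣ q ∣
∣++∣ []          q = refl
∣++∣ (true ∷ p)  q = cong suc (∣++∣ p q)
∣++∣ (false ∷ p) q = ∣++∣ p q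

∣++∩++∣ : ∀ {a b} (p p' : Subset a) (q q' : Subset b) → ∣ (p ++ q) ∩ (p' ++ q') ∣ ≡ ∣ p ∩ p' ∣ + ∣ q ∩ q' ∣
∣++∩++∣ p p' q q' = trans (cong ∣_∣ (zipWith-++ _ p q p' q')) (∣++∣ (p ∩ p') (q ∩ q'))

∣++∩++∣≡ : ∀ {a b x y} (p p' : Subset a) (q q' : Subset b) →
           ∣ p ∩ p' ∣ ≡ x → ∣ q ∩ q' ∣ ≡ y → ∣ (p ++ q) ∩ (p' ++ q') ∣ ≡ x + y
∣++∩++∣≡ p p' q q' eq₁ eq₂ = trans (∣++∩++∣ p p' q q') (cong₂ _+_ eq₁ eq₂)

∣++∩++∣≤ : ∀ {a b x y} (p p' : Subset a) (q q' : Subset b) →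
           ∣ p ∩ p' ∣ ≤ x → ∣ q ∩ q' ∣ ≤ y → ∣ (p ++ q) ∩ (p' ++ q') ∣ ≤ x + y
∣++∩++∣≤ p p' q q' le₁ le₂ = ≤-trans (≤-reflexive (∣++∩++∣ p p' q q')) (+-mono-≤ le₁ le₂)

∣p∪q∣+∣p∩q∣≡∣p∣+∣q∣ : ∀ {n} (p q : Subset n) → ∣ p ∪ q ∣ + ∣ p ∩ q ∣ ≡ ∣ p ∣ + ∣ q ∣
∣p∪q∣+∣p∩q∣≡∣p∣+∣q∣ []          []          = refl
∣p∪q∣+∣p∩q∣≡∣p∣+∣q∣ (true ∷ p)  (true ∷ q)  =
  cong suc (trans (+-suc _ _) (trans (cong suc (∣p∪q∣+∣p∩q∣≡∣p∣+∣q∣ p q)) (sym (+-suc _ _))))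
∣p∪q∣+∣p∩q∣≡∣p∣+∣q∣ (true ∷ p)  (false ∷ q) = cong suc (∣p∪q∣+∣p∩q∣≡∣p∣+∣q∣ p q)
∣p∪q∣+∣p∩q∣≡∣p∣+∣q∣ (false ∷ p) (true ∷ q)  = trans (cong suc (∣p∪q∣+∣p∩q∣≡∣p∣+∣q∣ p q)) (sym (+-suc _ _))
∣p∪q∣+∣p∩q∣≡∣p∣+∣q∣ (false ∷ p) (false ∷ q) = ∣p∪q∣+∣p∩q∣≡∣p∣+∣q∣ p q

∣p∪q∣≤∣p∣+∣q∣ : ∀ {n} (p q : Subset n) → ∣ p ∪ q ∣ ≤ ∣ p ∣ + ∣ q ∣
∣p∪q∣≤∣p∣+∣q∣ p q = ≤-trans (m≤m+n _ _) (≤-reflexive (∣p∪q∣+∣p∩q∣≡∣p∣+∣q∣ p q))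

∣[p∪q]∩r∣≤∣p∩r∣+∣q∩r∣ : ∀ {n} (p q r : Subset n) → ∣ (p ∪ q) ∩ r ∣ ≤ ∣ p ∩ r ∣ + ∣ q ∩ r ∣
∣[p∪q]∩r∣≤∣p∩r∣+∣q∩r∣ p q r =
  subst (_≤ ∣ p ∩ r ∣ + ∣ q ∩ r ∣) (cong ∣_∣ (sym (∩-distribʳ-∪ r p q))) (∣p∪q∣≤∣p∣+∣q∣ (p ∩ r) (q ∩ r))

-- The singleton {a} of Fin n, with a given as a natural number; it is empty when n ≤ a.
pt : ∀ n → ℕ → Subset n
pt zero    _       = []
pt (suc n) zero    = true ∷ ⊥
pt (suc n) (suc a) = false ∷ pt n a

∣pt∣≤1 : ∀ n a → ∣ pt n a ∣ ≤ 1
∣pt∣≤1 zero    _       = z≤n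
∣pt∣≤1 (suc n) zero    = s≤s (≤-reflexive (∣⊥∣≡0 n))
∣pt∣≤1 (suc n) (suc a) = ∣pt∣≤1 n a

∣pt∣≡1 : ∀ n {a} → a < n → ∣ pt n a ∣ ≡ 1
∣pt∣≡1 (suc n) {zero}  _         = cong suc (∣⊥∣≡0 n)
∣pt∣≡1 (suc n) {suc a} (s≤s a<n) = ∣pt∣≡1 n a<n

∣∩∣-comm : ∀ {n} (p q : Subset n) → ∣ p ∩ q ∣ ≡ ∣ q ∩ p ∣
∣∩∣-comm p q = cong ∣_∣ (∩-comm p q)

∣∩∣-cong : ∀ {n} {p p' q q' : Subset n} → p ≡ p' → q ≡ q' → ∣ p ∩ q ∣ ≡ ∣ p' ∩ q' ∣
∣∩∣-cong refl refl = refl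

∣∩∣≤-cong : ∀ {n x} {p p' q q' : Subset n} → p ≡ p' → q ≡ q' → ∣ p' ∩ q' ∣ ≤ x → ∣ p ∩ q ∣ ≤ x
∣∩∣≤-cong refl refl le = le

∣⊥∩p∣≡0 : ∀ {n} (p : Subset n) → ∣ ⊥ ∩ p ∣ ≡ 0
∣⊥∩p∣≡0 {n} p = trans (cong ∣_∣ (∩-zeroˡ p)) (∣⊥∣≡0 n)

∣pt∩pt∣≡1 : ∀ n {a} → a < n → ∣ pt n a ∩ pt n a ∣ ≡ 1
∣pt∩pt∣≡1 n {a} a<n = trans (cong ∣_∣ (∩-idem (pt n a))) (∣pt∣≡1 n a<n)

∣pt∩pt∣≡0 : ∀ n {a b} → a ≢ b → ∣ pt n a ∩ pt n b ∣ ≡ 0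
∣pt∩pt∣≡0 zero                      _   = refl
∣pt∩pt∣≡0 (suc n) {zero}  {zero}  a≢b = ⊥-elim (a≢b refl)
∣pt∩pt∣≡0 (suc n) {zero}  {suc b} _   = ∣⊥∩p∣≡0 (pt n b)
∣pt∩pt∣≡0 (suc n) {suc a} {zero}  _   = trans (∣∩∣-comm (pt n a) ⊥) (∣⊥∩p∣≡0 (pt n a))
∣pt∩pt∣≡0 (suc n) {suc a} {suc b} a≢b = ∣pt∩pt∣≡0 n (a≢b ∘ cong suc)

∣pt∩p∣≤1 : ∀ {n} a (p : Subset n) → ∣ pt n a ∩ p ∣ ≤ 1
∣pt∩p∣≤1 {n} a p = ≤-trans (∣p∩q∣≤∣p∣ (pt n a) p) (∣pt∣≤1 n a)

pair : ∀ n → ℕ → ℕ → Subset n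
pair n a b = pt n a ∪ pt n b

∣pair∣≡2 : ∀ n {a b} → a < n → b < n → a ≢ b → ∣ pair n a b ∣ ≡ 2
∣pair∣≡2 n {a} {b} a<n b<n a≢b = begin
  ∣ pair n a b ∣                             ≡⟨ sym (+-identityʳ _) ⟩
  ∣ pair n a b ∣ + 0                         ≡⟨ cong (∣ pair n a b ∣ +_) (sym (∣pt∩pt∣≡0 n a≢b)) ⟩
  ∣ pair n a b ∣ + ∣ pt n a ∩ pt n b ∣       ≡⟨ ∣p∪q∣+∣p∩q∣≡∣p∣+∣q∣ (pt n a) (pt n b) ⟩
  ∣ pt n a ∣ + ∣ pt n b ∣                    ≡⟨ cong₂ _+_ (∣pt∣≡1 n a<n) (∣pt∣≡1 n b<n) ⟩
  2                                          ∎
  where open ≡-Reasoning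

∣pt∩pair∣≡1ˡ : ∀ n {a} b → a < n → ∣ pt n a ∩ pair n a b ∣ ≡ 1
∣pt∩pair∣≡1ˡ n {a} b a<n = ≤-antisym (∣pt∩p∣≤1 a (pair n a b)) (begin
  1                                          ≡⟨ sym (∣pt∩pt∣≡1 n a<n) ⟩
  ∣ pt n a ∩ pt n a ∣                        ≤⟨ ∣p∣≤∣p∪q∣ (pt n a ∩ pt n a) (pt n a ∩ pt n b) ⟩
  ∣ (pt n a ∩ pt n a) ∪ (pt n a ∩ pt n b) ∣  ≡⟨ cong ∣_∣ (sym (∩-distribˡ-∪ (pt n a) _ _)) ⟩
  ∣ pt n a ∩ pair n a b ∣                    ∎)
  where open ≤-Reasoning

∣pt∩pair∣≡1ʳ : ∀ n a {b} → b < n → ∣ pt n b ∩ pair n a b ∣ ≡ 1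
∣pt∩pair∣≡1ʳ n a {b} b<n = ≤-antisym (∣pt∩p∣≤1 b (pair n a b)) (begin
  1                                          ≡⟨ sym (∣pt∩pt∣≡1 n b<n) ⟩
  ∣ pt n b ∩ pt n b ∣                        ≤⟨ ∣q∣≤∣p∪q∣ (pt n b ∩ pt n a) (pt n b ∩ pt n b) ⟩
  ∣ (pt n b ∩ pt n a) ∪ (pt n b ∩ pt n b) ∣  ≡⟨ cong ∣_∣ (sym (∩-distribˡ-∪ (pt n b) _ _)) ⟩
  ∣ pt n b ∩ pair n a b ∣                    ∎)
  where open ≤-Reasoning

∣pair∩p∣≤2 : ∀ {n} a b (p : Subset n) → ∣ pair n a b ∩ p ∣ ≤ 2
∣pair∩p∣≤2 a b p =
  ≤-trans (∣[p∪q]∩r∣≤∣p∩r∣+∣q∩r∣ (pt _ a) (pt _ b) p) (+-mono-≤ (∣pt∩p∣≤1 a p) (∣pt∩p∣≤1 b p))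

∣pair∩pt∣≡0 : ∀ n {a b c} → a ≢ c → b ≢ c → ∣ pair n a b ∩ pt n c ∣ ≡ 0
∣pair∩pt∣≡0 n {a} {b} {c} a≢c b≢c = n≤0⇒n≡0 (≤-trans (∣[p∪q]∩r∣≤∣p∩r∣+∣q∩r∣ (pt n a) (pt n b) (pt n c))
  (≤-reflexive (cong₂ _+_ (∣pt∩pt∣≡0 n a≢c) (∣pt∩pt∣≡0 n b≢c))))

∣pt∩pair∣≡0 : ∀ n {a b c} → c ≢ a → c ≢ b → ∣ pt n c ∩ pair n a b ∣ ≡ 0
∣pt∩pair∣≡0 n {a} {b} {c} c≢a c≢b =
  trans (∣∩∣-comm (pt n c) (pair n a b)) (∣pair∩pt∣≡0 n (≢-sym c≢a) (≢-sym c≢b))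

∣pair∩pair∣≤1 : ∀ n {a b a' b'} → a ≢ a' → b ≢ b' → ¬ (a ≡ b' × b ≡ a') →
                ∣ pair n a b ∩ pair n a' b' ∣ ≤ 1
∣pair∩pair∣≤1 n {a} {b} {a'} {b'} a≢a' b≢b' noSwap =
  ≤-trans (∣[p∪q]∩r∣≤∣p∩r∣+∣q∩r∣ (pt n a) (pt n b) P') (by-cases (a ≟ b'))
  where
  P' = pair n a' b'
  by-cases : Dec (a ≡ b') → ∣ pt n a ∩ P' ∣ + ∣ pt n b ∩ P' ∣ ≤ 1
  by-cases (yes a≡b') rewrite ∣pt∩pair∣≡0 n (λ b≡a' → noSwap (a≡b' , b≡a')) b≢b' =
    subst (_≤ 1) (sym (+-identityʳ _)) (∣pt∩p∣≤1 a P')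
  by-cases (no a≢b') rewrite ∣pt∩pair∣≡0 n a≢a' a≢b' = ∣pt∩p∣≤1 b P'

module InducedPath {n k} (f : ℕ → Subset n) (L : ℕ)
  (∣f∣      : ∀ i → i < L → ∣ f i ∣ ≡ suc k)
  (adjacent : ∀ i → suc i < L → ∣ f i ∩ f (suc i) ∣ ≡ k)
  (far      : ∀ i j → j < L → 2 + i ≤ j → ∣ f i ∩ f j ∣ < k)
  where

  C : Complex n
  C = applyUpTo f L

  f∈C : ∀ {i} → i < L → f i ∈ C
  f∈C = ∈-applyUpTo⁺ f

  head∈C : ∀ {X Y m} → Walk (suc k) C X Y m → X ∈ C
  head∈C (here X∈C)     = X∈C
  head∈C (step X∈C _ _) = X∈C

  adjacent⇒≤1+ : ∀ i {j} → j < L → Adjacent (suc k) (f i) (f j) → j ≤ suc i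
  adjacent⇒≤1+ i {j} j<L adj with 2 + i ≤? j
  ... | yes 2+i≤j = ⊥-elim (<-irrefl adj (far i j j<L 2+i≤j))
  ... | no  2+i≰j = ≤-pred (≰⇒> 2+i≰j)

  ≡⇒≤ : ∀ {i j} → i < L → j < L → f i ≡ f j → j ≤ i
  ≡⇒≤ {i} {j} i<L j<L fi≡fj with 2 + i ≤? j | suc i ≟ j
  ... | yes 2+i≤j | _        = ⊥-elim (<-asym (far i j j<L 2+i≤j) (≤-reflexive (sym ∣fi∩fj∣≡1+k)))
    where
    ∣fi∩fj∣≡1+k : ∣ f i ∩ f j ∣ ≡ suc k
    ∣fi∩fj∣≡1+k = trans (cong (λ X → ∣ f i ∩ X ∣) (sym fi≡fj)) (trans (cong ∣_∣ (∩-idem (f i))) (∣f∣ i i<L))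
  ... | no _      | yes refl = ⊥-elim (1+n≢n (begin
    suc k                 ≡⟨ ∣f∣ i i<L ⟨
    ∣ f i ∣               ≡⟨ cong ∣_∣ (∩-idem (f i)) ⟨
    ∣ f i ∩ f i ∣         ≡⟨ cong (λ X → ∣ f i ∩ X ∣) fi≡fj ⟩
    ∣ f i ∩ f (suc i) ∣   ≡⟨ adjacent i j<L ⟩
    k                     ∎))
    where open ≡-Reasoning
  ... | no 2+i≰j  | no 1+i≢j = ≤-pred (≤∧≢⇒< (≤-pred (≰⇒> 2+i≰j)) (≢-sym 1+i≢j))

  -- Each step of a walk advances the index by at most one.
  walk-length : ∀ {X Y m} → Walk (suc k) C X Y m → ∀ {i j} → i < L → j < L → X ≡ f i → Y ≡ f j → j ≤ i + m
  walk-length (here _) {i} i<L j<L refl Y≡fj = ≤-trans (≡⇒≤ i<L j<L Y≡fj) (≤-reflexive (sym (+-identityʳ i)))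
  walk-length (step {m = m} _ adj w) {i} i<L j<L refl Y≡fj with ∈-applyUpTo⁻ f (head∈C w)
  ... | i' , i'<L , refl = begin
    _             ≤⟨ walk-length w i'<L j<L refl Y≡fj ⟩
    i' + m        ≤⟨ +-monoˡ-≤ m (adjacent⇒≤1+ i i'<L adj) ⟩
    suc i + m     ≡⟨ +-suc i m ⟨
    i + suc m     ∎
    where open ≤-Reasoning

  walk-up : ∀ i m → i + m < L → Walk (suc k) C (f i) (f (i + m)) m
  walk-up i zero i+0<L rewrite +-identityʳ i = here (f∈C i+0<L)
  walk-up i (suc m) i+1+m<L rewrite +-suc i m =
    step (f∈C (≤-trans (s≤s (m≤m+n i m)) (<⇒≤ i+1+m<L)))
         (adjacent i (≤-trans (s≤s (s≤s (m≤m+n i m))) i+1+m<L))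
         (walk-up (suc i) m i+1+m<L)

  walk-down : ∀ i m → i + m < L → Walk (suc k) C (f (i + m)) (f i) m
  walk-down i zero i+0<L rewrite +-identityʳ i = here (f∈C i+0<L)
  walk-down i (suc m) i+1+m<L rewrite +-suc i m =
    step (f∈C i+1+m<L) (trans (∣∩∣-comm (f (suc (i + m))) (f (i + m))) (adjacent (i + m) i+1+m<L))
         (walk-down i m (<-trans (n<1+n (i + m)) i+1+m<L))

  pure : IsPure (suc k) C
  pure = All.tabulate λ X∈C → case ∈-applyUpTo⁻ f X∈C of λ where
    (i , i<L , refl) → ∣f∣ i i<L

  connected : ∀ X Y → X ∈ C → Y ∈ C → ∃[ m ] (Walk (suc k) C X Y m × m ≤ L ∸ 1)
  connected X Y X∈C Y∈C with ∈-applyUpTo⁻ f X∈C | ∈-applyUpTo⁻ f Y∈C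
  ... | i , i<L , refl | j , j<L , refl with ≤-total i j
  ...   | inj₁ i≤j = j ∸ i
                   , subst (λ x → Walk (suc k) C (f i) (f x) (j ∸ i)) (m+[n∸m]≡n i≤j)
                       (walk-up i (j ∸ i) (subst (_< L) (sym (m+[n∸m]≡n i≤j)) j<L))
                   , ≤-trans (m∸n≤m j i) (∸-monoˡ-≤ 1 j<L)
  ...   | inj₂ j≤i = i ∸ j
                   , subst (λ x → Walk (suc k) C (f x) (f j) (i ∸ j)) (m+[n∸m]≡n j≤i)
                       (walk-down j (i ∸ j) (subst (_< L) (sym (m+[n∸m]≡n j≤i)) i<L))
                   , ≤-trans (m∸n≤m i j) (∸-monoˡ-≤ 1 i<L)

  strongly-connected : StronglyConnected (suc k) C
  strongly-connected X Y X∈C Y∈C = proj₁ c , proj₁ (proj₂ c)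
    where c = connected X Y X∈C Y∈C

  diameter : 0 < L → Diameter (suc k) C (L ∸ 1)
  diameter 0<L = connected , f 0 , f (L ∸ 1) , f∈C 0<L , f∈C last<L , walk-up 0 (L ∸ 1) last<L ,
                 λ m w → walk-length w 0<L last<L refl refl
    where
    last<L : L ∸ 1 < L
    last<L = ≤-reflexive (m+[n∸m]≡n 0<L)

module Columns (r : ℕ) where

  Q : ℕ
  Q = suc (suc r)

  q : ℕ
  q = suc Q

  next : ℕ → ℕ
  next c = suc c % q

  next-suc : ∀ {c} → suc c < q → next c ≡ suc c
  next-suc = m<n⇒m%n≡m

  next-Q : next Q ≡ 0
  next-Q = n%n≡0 q

  suc<q⇒<q : ∀ {c} → suc c < q → c < q
  suc<q⇒<q = <-trans (n<1+n _)

  <q∧≢Q⇒suc<q : ∀ {c} → c < q → c ≢ Q → suc c < q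
  <q∧≢Q⇒suc<q c<q c≢Q = s≤s (≤∧≢⇒< (≤-pred c<q) c≢Q)

  label : ℕ → ℕ → ℕ
  label c s = ((q ∸ s) + c) % q

  label<q : ∀ c s → label c s < q
  label<q c s = m%n<n ((q ∸ s) + c) q

  label-injectiveˡ : ∀ {c c'} s → c < q → c' < q → c ≢ c' → label c s ≢ label c' s
  label-injectiveˡ s c<q c'<q c≢c' eq = c≢c' (+-%-cancelˡ q (q ∸ s) eq c<q c'<q)

  label-injectiveʳ-≤ : ∀ c {s s'} → s ≤ s' → s' < q → label c s ≡ label c s' → s ≡ s'
  label-injectiveʳ-≤ c {s} {s'} s≤s' s'<q eq =
    sym (∸-cancelˡ-≡ (<⇒≤ s'<q) (≤-trans s≤s' (<⇒≤ s'<q)) (+-cancelʳ-≡ c (q ∸ s') (q ∸ s) same))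
    where
    open ≤-Reasoning
    below : (q ∸ s) + c < (q ∸ s') + c + q
    below = begin-strict
      (q ∸ s) + c         ≤⟨ +-monoˡ-≤ c (m∸n≤m q s) ⟩
      q + c               ≡⟨ +-comm q c ⟩
      c + q               <⟨ +-monoˡ-≤ (c + q) (m<n⇒0<n∸m s'<q) ⟩
      (q ∸ s') + (c + q)  ≡⟨ +-assoc (q ∸ s') c q ⟨
      (q ∸ s') + c + q    ∎
    same : (q ∸ s') + c ≡ (q ∸ s) + c
    same = %-injective-window q (sym eq) (+-monoˡ-≤ c (∸-monoʳ-≤ q s≤s')) below

  label-injectiveʳ : ∀ c {s s'} → s < q → s' < q → s ≢ s' → label c s ≢ label c s'
  label-injectiveʳ c {s} {s'} s<q s'<q s≢s' eq with ≤-total s s'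
  ... | inj₁ s≤s' = s≢s' (label-injectiveʳ-≤ c s≤s' s'<q eq)
  ... | inj₂ s'≤s = s≢s' (sym (label-injectiveʳ-≤ c s'≤s s<q (sym eq)))

  label-wrap : ∀ {s} → s < q → label Q s ≡ label 0 (next s)
  label-wrap {s} s<q with suc s <? q
  ... | yes 1+s<q = begin
    ((q ∸ s) + Q) % q             ≡⟨ cong (λ x → (x + Q) % q) (m∸n≡1+[m∸1+n] s<q) ⟩
    (suc (q ∸ suc s) + Q) % q     ≡⟨ cong (_% q) (+-suc (q ∸ suc s) Q) ⟨
    ((q ∸ suc s) + q) % q         ≡⟨ [m+n]%n≡m%n (q ∸ suc s) q ⟩
    (q ∸ suc s) % q               ≡⟨ cong (_% q) (+-identityʳ (q ∸ suc s)) ⟨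
    ((q ∸ suc s) + 0) % q         ≡⟨ cong (λ x → ((q ∸ x) + 0) % q) (next-suc 1+s<q) ⟨
    ((q ∸ next s) + 0) % q        ∎
    where open ≡-Reasoning
  ... | no 1+s≮q = begin
    ((q ∸ s) + Q) % q             ≡⟨ cong (λ x → ((q ∸ x) + Q) % q) s≡Q ⟩
    ((q ∸ Q) + Q) % q             ≡⟨ cong (λ x → (x + Q) % q) (m+n∸n≡m 1 Q) ⟩
    q % q                         ≡⟨ cong (_% q) (+-identityʳ q) ⟨
    (q + 0) % q                   ≡⟨ cong (λ x → ((q ∸ x) + 0) % q) (trans (cong next s≡Q) next-Q) ⟨
    ((q ∸ next s) + 0) % q        ∎
    where
    open ≡-Reasoning
    s≡Q : s ≡ Q
    s≡Q = ≤-antisym (≤-pred s<q) (≤-pred (≮⇒≥ 1+s≮q))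

  -- This is where q ≥ 3 is needed: otherwise c − s ≡ c + 1 − s' and c + 1 − s ≡ c − s' can both hold.
  label-no-swap : ∀ c s s' → ¬ (label c s ≡ label (suc c) s' × label (suc c) s ≡ label c s')
  label-no-swap c s s' (fwd , bwd) =
    2≢0 (+-%-cancelˡ q x (trans (cong (_% q) (+-comm x 2)) x+2≡x) (s≤s (s≤s (s≤s z≤n))) (s≤s z≤n))
    where
    x = (q ∸ s) + c
    y = (q ∸ s') + c
    shift : ∀ a → suc a % q ≡ (a + 1) % q
    shift a = cong (_% q) (+-comm 1 a)
    x+2≡x : suc (suc x) % q ≡ (x + 0) % q
    x+2≡x = begin
      suc (suc x) % q   ≡⟨ shift (suc x) ⟩
      (suc x + 1) % q   ≡⟨ %-congˡ-+ q {suc x} {y} 1 (trans (sym (cong (_% q) (+-suc (q ∸ s) c))) bwd) ⟩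
      (y + 1) % q       ≡⟨ shift y ⟨
      suc y % q         ≡⟨ trans fwd (cong (_% q) (+-suc (q ∸ s') c)) ⟨
      x % q             ≡⟨ cong (_% q) (+-identityʳ x) ⟨
      (x + 0) % q       ∎
      where open ≡-Reasoning
    2≢0 : 2 ≢ 0
    2≢0 ()

-- Column c < q is the path facet c 0, …, facet c (len ∸ 1); bridge c is the ridge leading to column next c.
record Necklace (r k n len : ℕ) : Set where
  open Columns r
  field
    facet            : ℕ → ℕ → Subset n
    bridge           : ℕ → Subset n
    ∣facet∣          : ∀ c i → c < q → i < len → ∣ facet c i ∣ ≡ 2 + k
    facet-adjacent   : ∀ c i → c < q → suc i < len → ∣ facet c i ∩ facet c (suc i) ∣ ≡ suc k
    facet-far        : ∀ c i j → c < q → j < len → 2 + i ≤ j → ∣ facet c i ∩ facet c j ∣ ≤ k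
    facet-cross      : ∀ c c' i j → c < q → c' < q → c ≢ c' → i < len → j < len →
                       ∣ facet c i ∩ facet c' j ∣ ≤ suc k
    ∣bridge∣         : ∀ c → c < q → ∣ bridge c ∣ ≡ suc k
    bridge-last      : ∀ c → c < q → ∣ bridge c ∩ facet c (len ∸ 1) ∣ ≡ suc k
    bridge-first     : ∀ c → c < q → ∣ bridge c ∩ facet (next c) 0 ∣ ≡ suc k
    bridge-far-last  : ∀ c i → c < q → suc i < len → ∣ bridge c ∩ facet c i ∣ ≤ k
    bridge-far-first : ∀ c j → c < q → 0 < j → j < len → ∣ bridge c ∩ facet (next c) j ∣ ≤ k
    bridge-cross     : ∀ c c' → c < q → c' < q → c ≢ c' → ∣ bridge c ∩ bridge c' ∣ ≤ k

module Lift {r k n len} (0<len : 0 < len) (N : Necklace r k n len) where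
  open Columns r
  open Necklace N

  tag : ℕ → ℕ → Subset q
  tag s c = pt q (label c s)

  tags : ℕ → ℕ → Subset q
  tags s c = pair q (label c s) (label (suc c) s)

  raised : ℕ → ℕ → ℕ → Subset (q + n)
  raised s c i = tag s c ++ facet c i

  joint : ℕ → ℕ → Subset (q + n)
  joint s c = tags s c ++ bridge c

  bridge′ : ℕ → Subset (q + n)
  bridge′ s = tag s Q ++ bridge Q

  ∣tag∩p∣≤1 : ∀ s c (p : Subset q) → ∣ tag s c ∩ p ∣ ≤ 1
  ∣tag∩p∣≤1 s c = ∣pt∩p∣≤1 (label c s)

  ∣bridge∩p∣≤1+k : ∀ {c} → c < q → (p : Subset n) → ∣ bridge c ∩ p ∣ ≤ suc k
  ∣bridge∩p∣≤1+k {c} c<q p = ≤-trans (∣p∩q∣≤∣p∣ (bridge c) p) (≤-reflexive (∣bridge∣ c c<q))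

  ∣p∩bridge∣≤1+k : ∀ {c} → c < q → (p : Subset n) → ∣ p ∩ bridge c ∣ ≤ suc k
  ∣p∩bridge∣≤1+k {c} c<q p = ≤-trans (∣p∩q∣≤∣q∣ p (bridge c)) (≤-reflexive (∣bridge∣ c c<q))

  ∣raised∣ : ∀ s c i → c < q → i < len → ∣ raised s c i ∣ ≡ 3 + k
  ∣raised∣ s c i c<q i<len =
    trans (∣++∣ (tag s c) (facet c i)) (cong₂ _+_ (∣pt∣≡1 q (label<q c s)) (∣facet∣ c i c<q i<len))

  ∣joint∣ : ∀ s c → suc c < q → ∣ joint s c ∣ ≡ 3 + k
  ∣joint∣ s c 1+c<q = trans (∣++∣ (tags s c) (bridge c)) (cong₂ _+_
    (∣pair∣≡2 q (label<q c s) (label<q (suc c) s) (label-injectiveˡ s (suc<q⇒<q 1+c<q) 1+c<q (<⇒≢ (n<1+n c))))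
    (∣bridge∣ c (suc<q⇒<q 1+c<q)))

  ∣bridge′∣ : ∀ s → ∣ bridge′ s ∣ ≡ 2 + k
  ∣bridge′∣ s = trans (∣++∣ (tag s Q) (bridge Q)) (cong₂ _+_ (∣pt∣≡1 q (label<q Q s)) (∣bridge∣ Q ≤-refl))

  raised-adjacent : ∀ s c i → c < q → suc i < len → ∣ raised s c i ∩ raised s c (suc i) ∣ ≡ 2 + k
  raised-adjacent s c i c<q 1+i<len = ∣++∩++∣≡ (tag s c) (tag s c) (facet c i) (facet c (suc i))
    (∣pt∩pt∣≡1 q (label<q c s)) (facet-adjacent c i c<q 1+i<len)

  raised-joint-adjacent : ∀ s c → suc c < q → ∣ raised s c (len ∸ 1) ∩ joint s c ∣ ≡ 2 + k
  raised-joint-adjacent s c 1+c<q = ∣++∩++∣≡ (tag s c) (tags s c) (facet c (len ∸ 1)) (bridge c)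
    (∣pt∩pair∣≡1ˡ q (label (suc c) s) (label<q c s))
    (trans (∣∩∣-comm (facet c (len ∸ 1)) (bridge c)) (bridge-last c (suc<q⇒<q 1+c<q)))

  joint-raised-adjacent : ∀ s c → suc c < q → ∣ joint s c ∩ raised s (suc c) 0 ∣ ≡ 2 + k
  joint-raised-adjacent s c 1+c<q = ∣++∩++∣≡ (tags s c) (tag s (suc c)) (bridge c) (facet (suc c) 0)
    (trans (∣∩∣-comm (tags s c) (tag s (suc c))) (∣pt∩pair∣≡1ʳ q (label c s) (label<q (suc c) s)))
    (subst (λ c' → ∣ bridge c ∩ facet c' 0 ∣ ≡ suc k) (next-suc 1+c<q) (bridge-first c (suc<q⇒<q 1+c<q)))

  raised-far : ∀ s c i j → c < q → j < len → 2 + i ≤ j → ∣ raised s c i ∩ raised s c j ∣ ≤ suc k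
  raised-far s c i j c<q j<len 2+i≤j = ∣++∩++∣≤ (tag s c) (tag s c) (facet c i) (facet c j)
    (∣tag∩p∣≤1 s c (tag s c)) (facet-far c i j c<q j<len 2+i≤j)

  raised-joint-far : ∀ s c i → c < q → suc i < len → ∣ raised s c i ∩ joint s c ∣ ≤ suc k
  raised-joint-far s c i c<q 1+i<len = ∣++∩++∣≤ (tag s c) (tags s c) (facet c i) (bridge c)
    (∣tag∩p∣≤1 s c (tags s c)) (subst (_≤ k) (∣∩∣-comm (bridge c) (facet c i)) (bridge-far-last c i c<q 1+i<len))

  joint-raised-far : ∀ s c j → suc c < q → 0 < j → j < len → ∣ joint s c ∩ raised s (suc c) j ∣ ≤ suc k
  joint-raised-far s c j 1+c<q 0<j j<len = ∣++∩++∣≤ (tags s c) (tag s (suc c)) (bridge c) (facet (suc c) j)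
    (subst (_≤ 1) (∣∩∣-comm (tag s (suc c)) (tags s c)) (∣tag∩p∣≤1 s (suc c) (tags s c)))
    (subst (λ c' → ∣ bridge c ∩ facet c' j ∣ ≤ k) (next-suc 1+c<q) (bridge-far-first c j (suc<q⇒<q 1+c<q) 0<j j<len))

  raised-cross : ∀ s c c' i j → c < q → c' < q → c ≢ c' → i < len → j < len →
                 ∣ raised s c i ∩ raised s c' j ∣ ≤ suc k
  raised-cross s c c' i j c<q c'<q c≢c' i<len j<len = ∣++∩++∣≤ (tag s c) (tag s c') (facet c i) (facet c' j)
    (≤-reflexive (∣pt∩pt∣≡0 q (label-injectiveˡ s c<q c'<q c≢c'))) (facet-cross c c' i j c<q c'<q c≢c' i<len j<len)

  raised-joint-cross : ∀ s c c' i → c < q → suc c' < q → c ≢ c' → c ≢ suc c' →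
                       ∣ raised s c i ∩ joint s c' ∣ ≤ suc k
  raised-joint-cross s c c' i c<q 1+c'<q c≢c' c≢1+c' = ∣++∩++∣≤ (tag s c) (tags s c') (facet c i) (bridge c')
    (≤-reflexive (∣pt∩pair∣≡0 q (label-injectiveˡ s c<q (suc<q⇒<q 1+c'<q) c≢c')
                                (label-injectiveˡ s c<q 1+c'<q c≢1+c')))
    (∣p∩bridge∣≤1+k (suc<q⇒<q 1+c'<q) (facet c i))

  joint-cross : ∀ s c c' → suc c' < q → c < c' → ∣ joint s c ∩ joint s c' ∣ ≤ suc k
  joint-cross s c c' 1+c'<q c<c' = ∣++∩++∣≤ (tags s c) (tags s c') (bridge c) (bridge c')
    (∣pair∩pair∣≤1 q (label-injectiveˡ s c<q c'<q (<⇒≢ c<c'))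
                     (label-injectiveˡ s (<-trans (s≤s c<c') 1+c'<q) 1+c'<q (<⇒≢ (s≤s c<c')))
      (λ (same , _) → label-injectiveˡ s c<q 1+c'<q (<⇒≢ (<-trans c<c' (n<1+n c'))) same))
    (bridge-cross c c' c<q c'<q (<⇒≢ c<c'))
    where
    c'<q = suc<q⇒<q 1+c'<q
    c<q = <-trans c<c' c'<q

  copies-raised : ∀ {s s'} c c' i j → s < q → s' < q → s ≢ s' → c < q → c' < q → i < len → j < len →
                  ∣ raised s c i ∩ raised s' c' j ∣ ≤ 2 + k
  copies-raised {s} {s'} c c' i j s<q s'<q s≢s' c<q c'<q i<len j<len with c ≟ c'
  ... | yes refl = ∣++∩++∣≤ (tag s c) (tag s' c) (facet c i) (facet c j)
    (≤-reflexive (∣pt∩pt∣≡0 q (label-injectiveʳ c s<q s'<q s≢s')))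
    (≤-trans (∣p∩q∣≤∣p∣ (facet c i) (facet c j)) (≤-reflexive (∣facet∣ c i c<q i<len)))
  ... | no c≢c' = ∣++∩++∣≤ (tag s c) (tag s' c') (facet c i) (facet c' j)
    (∣tag∩p∣≤1 s c (tag s' c')) (facet-cross c c' i j c<q c'<q c≢c' i<len j<len)

  copies-raised-joint : ∀ s s' c c' i → suc c' < q → ∣ raised s c i ∩ joint s' c' ∣ ≤ 2 + k
  copies-raised-joint s s' c c' i 1+c'<q = ∣++∩++∣≤ (tag s c) (tags s' c') (facet c i) (bridge c')
    (∣tag∩p∣≤1 s c (tags s' c')) (∣p∩bridge∣≤1+k (suc<q⇒<q 1+c'<q) (facet c i))

  copies-joint : ∀ {s s'} c c' → s < q → s' < q → s ≢ s' → suc c < q → suc c' < q →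
                 ∣ joint s c ∩ joint s' c' ∣ ≤ 2 + k
  copies-joint {s} {s'} c c' s<q s'<q s≢s' 1+c<q 1+c'<q with c ≟ c'
  ... | yes refl = ∣++∩++∣≤ (tags s c) (tags s' c) (bridge c) (bridge c)
    (∣pair∩pair∣≤1 q (label-injectiveʳ c s<q s'<q s≢s') (label-injectiveʳ (suc c) s<q s'<q s≢s')
                     (label-no-swap c s s'))
    (∣bridge∩p∣≤1+k (suc<q⇒<q 1+c<q) (bridge c))
  ... | no c≢c' = ∣++∩++∣≤ (tags s c) (tags s' c') (bridge c) (bridge c')
    (∣pair∩p∣≤2 (label c s) (label (suc c) s) (tags s' c'))
    (bridge-cross c c' (suc<q⇒<q 1+c<q) (suc<q⇒<q 1+c'<q) c≢c')

  bridge′-last : ∀ s → ∣ bridge′ s ∩ raised s Q (len ∸ 1) ∣ ≡ 2 + k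
  bridge′-last s = ∣++∩++∣≡ (tag s Q) (tag s Q) (bridge Q) (facet Q (len ∸ 1))
    (∣pt∩pt∣≡1 q (label<q Q s)) (bridge-last Q ≤-refl)

  bridge′-first : ∀ s → s < q → ∣ bridge′ s ∩ raised (next s) 0 0 ∣ ≡ 2 + k
  bridge′-first s s<q = ∣++∩++∣≡ (tag s Q) (tag (next s) 0) (bridge Q) (facet 0 0)
    (subst (λ l → ∣ tag s Q ∩ pt q l ∣ ≡ 1) (label-wrap s<q) (∣pt∩pt∣≡1 q (label<q Q s)))
    (subst (λ c → ∣ bridge Q ∩ facet c 0 ∣ ≡ suc k) next-Q (bridge-first Q ≤-refl))

  bridge′-cross : ∀ {s s'} → s < q → s' < q → s ≢ s' → ∣ bridge′ s ∩ bridge′ s' ∣ ≤ suc k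
  bridge′-cross {s} {s'} s<q s'<q s≢s' = ∣++∩++∣≤ (tag s Q) (tag s' Q) (bridge Q) (bridge Q)
    (≤-reflexive (∣pt∩pt∣≡0 q (label-injectiveʳ Q s<q s'<q s≢s'))) (∣bridge∩p∣≤1+k ≤-refl (bridge Q))

  bridge′-joint : ∀ s s' c → suc c < q → ∣ bridge′ s ∩ joint s' c ∣ ≤ suc k
  bridge′-joint s s' c 1+c<q = ∣++∩++∣≤ (tag s Q) (tags s' c) (bridge Q) (bridge c)
    (∣tag∩p∣≤1 s Q (tags s' c)) (bridge-cross Q c ≤-refl (suc<q⇒<q 1+c<q) (≢-sym (<⇒≢ (≤-pred 1+c<q))))

  bridge′-raised-far : ∀ s i → suc i < len → ∣ bridge′ s ∩ raised s Q i ∣ ≤ suc k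
  bridge′-raised-far s i 1+i<len = ∣++∩++∣≤ (tag s Q) (tag s Q) (bridge Q) (facet Q i)
    (∣tag∩p∣≤1 s Q (tag s Q)) (bridge-far-last Q i ≤-refl 1+i<len)

  bridge′-raised-cross : ∀ s c i → c < q → c ≢ Q → ∣ bridge′ s ∩ raised s c i ∣ ≤ suc k
  bridge′-raised-cross s c i c<q c≢Q = ∣++∩++∣≤ (tag s Q) (tag s c) (bridge Q) (facet c i)
    (≤-reflexive (∣pt∩pt∣≡0 q (label-injectiveˡ s ≤-refl c<q (≢-sym c≢Q))))
    (∣bridge∩p∣≤1+k ≤-refl (facet c i))

  bridge′-next-far : ∀ s j → 0 < j → j < len → ∣ bridge′ s ∩ raised (next s) 0 j ∣ ≤ suc k
  bridge′-next-far s j 0<j j<len = ∣++∩++∣≤ (tag s Q) (tag (next s) 0) (bridge Q) (facet 0 j)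
    (∣tag∩p∣≤1 s Q (tag (next s) 0))
    (subst (λ c → ∣ bridge Q ∩ facet c j ∣ ≤ k) next-Q (bridge-far-first Q j ≤-refl 0<j j<len))

  bridge′-next-cross : ∀ s c i → s < q → c < q → c ≢ 0 → ∣ bridge′ s ∩ raised (next s) c i ∣ ≤ suc k
  bridge′-next-cross s c i s<q c<q c≢0 = ∣++∩++∣≤ (tag s Q) (tag (next s) c) (bridge Q) (facet c i)
    (≤-reflexive (∣pt∩pt∣≡0 q (subst (_≢ label c (next s)) (sym (label-wrap s<q))
      (label-injectiveˡ (next s) (s≤s z≤n) c<q (≢-sym c≢0)))))
    (∣bridge∩p∣≤1+k ≤-refl (facet c i))

  S : ℕ
  S = suc len

  -- Position i of column c in a copy; positions pos c len are the joints.
  pos : ℕ → ℕ → ℕ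
  pos c i = c * S + i

  len′ : ℕ
  len′ = pos Q len

  cell : ℕ → ℕ → ℕ → Subset (q + n)
  cell s c i with i <? len
  ... | yes _ = raised s c i
  ... | no  _ = joint s c

  facet′ : ℕ → ℕ → Subset (q + n)
  facet′ s t = cell s (t / S) (t % S)

  cell-raised : ∀ s c {i} → i < len → cell s c i ≡ raised s c i
  cell-raised s c {i} i<len with i <? len
  ... | yes _     = refl
  ... | no  i≮len = ⊥-elim (i≮len i<len)

  cell-joint : ∀ s c → cell s c len ≡ joint s c
  cell-joint s c with len <? len
  ... | yes len<len = ⊥-elim (<-irrefl refl len<len)
  ... | no  _       = refl

  pos-mod : ∀ c {i} → i < S → pos c i % S ≡ i
  pos-mod c {i} i<S = trans (cong (_% S) (+-comm (c * S) i)) (trans ([m+kn]%n≡m%n i c S) (m<n⇒m%n≡m i<S))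

  pos-div : ∀ c {i} → i < S → pos c i / S ≡ c
  pos-div c {i} i<S = begin
    (c * S + i) / S        ≡⟨ +-distrib-/-∣ˡ i (n∣m*n c) ⟩
    c * S / S + i / S      ≡⟨ cong₂ _+_ (m*n/n≡m c S) (m<n⇒m/n≡0 i<S) ⟩
    c + 0                  ≡⟨ +-identityʳ c ⟩
    c                      ∎
    where open ≡-Reasoning

  pos-decompose : ∀ t → pos (t / S) (t % S) ≡ t
  pos-decompose t = trans (+-comm (t / S * S) (t % S)) (sym (m≡m%n+[m/n]*n t S))

  pos-next : ∀ c → suc (pos c len) ≡ pos (suc c) 0
  pos-next c = trans (cong suc (+-comm (c * S) len)) (sym (+-identityʳ (suc c * S)))

  pos-lex : ∀ {c c'} i i' → c < c' → i < S → pos c i < pos c' i'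
  pos-lex {c} {c'} i i' c<c' i<S = begin-strict
    c * S + i    <⟨ +-monoʳ-< (c * S) i<S ⟩
    c * S + S    ≡⟨ +-comm (c * S) S ⟩
    suc c * S    ≤⟨ *-monoˡ-≤ S c<c' ⟩
    c' * S       ≤⟨ m≤m+n (c' * S) i' ⟩
    c' * S + i'  ∎
    where open ≤-Reasoning

  facet′-at : ∀ s {t c i} → pos c i ≡ t → i < S → facet′ s t ≡ cell s c i
  facet′-at s {c = c} refl i<S = cong₂ (cell s) (pos-div c i<S) (pos-mod c i<S)

  data Slot (c i : ℕ) : Set where
    inColumn : c < q → i < len → Slot c i
    atJoint  : suc c < q → i ≡ len → Slot c i

  slot-i<S : ∀ {c i} → Slot c i → i < S
  slot-i<S (inColumn _ i<len) = m<n⇒m<1+n i<len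
  slot-i<S (atJoint _ refl)   = n<1+n len

  slot : ∀ {c i} → i < S → pos c i < len′ → Slot c i
  slot {c} {i} i<S p<len′ with c <? q | i <? len
  ... | no c≮q  | _         = ⊥-elim (<-asym p<len′ (pos-lex len i (≮⇒≥ c≮q) (n<1+n len)))
  ... | yes c<q | yes i<len = inColumn c<q i<len
  ... | yes c<q | no i≮len  = atJoint (<q∧≢Q⇒suc<q c<q c≢Q) i≡len
    where
    i≡len : i ≡ len
    i≡len = ≤-antisym (≤-pred i<S) (≮⇒≥ i≮len)
    c≢Q : c ≢ Q
    c≢Q refl = <-irrefl (cong (pos Q) i≡len) p<len′

  slotOf : ∀ t → t < len′ → Slot (t / S) (t % S)
  slotOf t t<len′ = slot (m%n<n t S) (subst (_< len′) (sym (pos-decompose t)) t<len′)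

  ∣cell∣ : ∀ s {c i} → Slot c i → ∣ cell s c i ∣ ≡ 3 + k
  ∣cell∣ s {c} (inColumn c<q i<len) = trans (cong ∣_∣ (cell-raised s c i<len)) (∣raised∣ s c _ c<q i<len)
  ∣cell∣ s {c} (atJoint 1+c<q refl) = trans (cong ∣_∣ (cell-joint s c)) (∣joint∣ s c 1+c<q)

  cell-adjacent : ∀ s {c i} → Slot c i → suc (pos c i) < len′ →
                  ∣ cell s c i ∩ facet′ s (suc (pos c i)) ∣ ≡ 2 + k
  cell-adjacent s {c} (atJoint 1+c<q refl) _ = trans
    (∣∩∣-cong (cell-joint s c) (trans (facet′-at s (sym (pos-next c)) (s≤s z≤n)) (cell-raised s (suc c) 0<len)))
    (joint-raised-adjacent s c 1+c<q)
  cell-adjacent s {c} {i} (inColumn c<q i<len) 1+p<len′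
    with slot (s≤s i<len) (subst (_< len′) (sym (+-suc (c * S) i)) 1+p<len′)
  ... | inColumn _ 1+i<len = trans
    (∣∩∣-cong (cell-raised s c i<len) (trans (facet′-at s (+-suc (c * S) i) (s≤s i<len)) (cell-raised s c 1+i<len)))
    (raised-adjacent s c i c<q 1+i<len)
  ... | atJoint 1+c<q 1+i≡len = trans
    (∣∩∣-cong (trans (cell-raised s c i<len) (cong (raised s c) (cong (_∸ 1) 1+i≡len)))
              (trans (facet′-at s (+-suc (c * S) i) (s≤s i<len)) (trans (cong (cell s c) 1+i≡len) (cell-joint s c))))
    (raised-joint-adjacent s c 1+c<q)

  cell-far : ∀ s {c i c' i'} → Slot c i → Slot c' i' → 2 + pos c i ≤ pos c' i' →
             ∣ cell s c i ∩ cell s c' i' ∣ ≤ suc k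
  cell-far s {c} {i} {c'} {i'} σ σ' far with <-cmp c c'
  ... | tri> _ _ c'<c = ⊥-elim (<-asym (pos-lex i' i c'<c (slot-i<S σ')) (≤-trans (n≤1+n _) far))
  cell-far s {c} {i} {c} {i'} σ σ' far | tri≈ _ refl _ = same-column σ σ'
    where
    2+i≤i' : 2 + i ≤ i'
    2+i≤i' = +-cancelˡ-≤ (c * S) (2 + i) i'
      (subst (_≤ c * S + i') (sym (trans (+-suc (c * S) (suc i)) (cong suc (+-suc (c * S) i)))) far)
    same-column : Slot c i → Slot c i' → ∣ cell s c i ∩ cell s c i' ∣ ≤ suc k
    same-column (inColumn c<q i<len) (inColumn _ i'<len) =
      ∣∩∣≤-cong (cell-raised s c i<len) (cell-raised s c i'<len) (raised-far s c i i' c<q i'<len 2+i≤i')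
    same-column (inColumn c<q i<len) (atJoint _ refl) =
      ∣∩∣≤-cong (cell-raised s c i<len) (cell-joint s c) (raised-joint-far s c i c<q 2+i≤i')
    same-column (atJoint _ refl) σ' =
      ⊥-elim (<-irrefl refl (≤-trans (≤-trans (n≤1+n _) 2+i≤i') (≤-pred (slot-i<S σ'))))
  ... | tri< c<c' _ _ = columns-apart σ σ'
    where
    columns-apart : Slot c i → Slot c' i' → ∣ cell s c i ∩ cell s c' i' ∣ ≤ suc k
    columns-apart (inColumn c<q i<len) (inColumn c'<q i'<len) =
      ∣∩∣≤-cong (cell-raised s c i<len) (cell-raised s c' i'<len)
        (raised-cross s c c' i i' c<q c'<q (<⇒≢ c<c') i<len i'<len)
    columns-apart (inColumn c<q i<len) (atJoint 1+c'<q refl) =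
      ∣∩∣≤-cong (cell-raised s c i<len) (cell-joint s c')
        (raised-joint-cross s c c' i c<q 1+c'<q (<⇒≢ c<c') (<⇒≢ (<-trans c<c' (n<1+n c'))))
    columns-apart (atJoint 1+c<q refl) (atJoint 1+c'<q refl) =
      ∣∩∣≤-cong (cell-joint s c) (cell-joint s c') (joint-cross s c c' 1+c'<q c<c')
    columns-apart (atJoint 1+c<q refl) (inColumn c'<q i'<len) with c' ≟ suc c
    ... | yes refl = ∣∩∣≤-cong (cell-joint s c) (cell-raised s (suc c) i'<len) (joint-raised-far s c i' 1+c<q 0<i' i'<len)
      where
      0<i' : 0 < i'
      0<i' = n≢0⇒n>0 λ { refl → 1+n≰n (≤-trans far (≤-reflexive (sym (pos-next c)))) }
    ... | no c'≢1+c = ∣∩∣≤-cong (cell-joint s c) (cell-raised s c' i'<len)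
      (subst (_≤ suc k) (∣∩∣-comm (raised s c' i') (joint s c))
        (raised-joint-cross s c' c i' c'<q 1+c<q (≢-sym (<⇒≢ c<c')) c'≢1+c))

  cell-copies : ∀ {s s'} → s < q → s' < q → s ≢ s' → ∀ {c i c' i'} → Slot c i → Slot c' i' →
                ∣ cell s c i ∩ cell s' c' i' ∣ ≤ 2 + k
  cell-copies {s} {s'} s<q s'<q s≢s' {c} {i} {c'} {i'} σ σ' = by-slots σ σ'
    where
    by-slots : Slot c i → Slot c' i' → ∣ cell s c i ∩ cell s' c' i' ∣ ≤ 2 + k
    by-slots (inColumn c<q i<len) (inColumn c'<q i'<len) =
      ∣∩∣≤-cong (cell-raised s c i<len) (cell-raised s' c' i'<len)
        (copies-raised c c' i i' s<q s'<q s≢s' c<q c'<q i<len i'<len)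
    by-slots (inColumn c<q i<len) (atJoint 1+c'<q refl) =
      ∣∩∣≤-cong (cell-raised s c i<len) (cell-joint s' c') (copies-raised-joint s s' c c' i 1+c'<q)
    by-slots (atJoint 1+c<q refl) (inColumn c'<q i'<len) =
      ∣∩∣≤-cong (cell-joint s c) (cell-raised s' c' i'<len)
        (subst (_≤ 2 + k) (∣∩∣-comm (raised s' c' i') (joint s c)) (copies-raised-joint s' s c' c i' 1+c<q))
    by-slots (atJoint 1+c<q refl) (atJoint 1+c'<q refl) =
      ∣∩∣≤-cong (cell-joint s c) (cell-joint s' c') (copies-joint c c' s<q s'<q s≢s' 1+c<q 1+c'<q)

  bridge′-cell-far : ∀ s {c i} → Slot c i → suc (pos c i) < len′ → ∣ bridge′ s ∩ cell s c i ∣ ≤ suc k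
  bridge′-cell-far s {c} (atJoint 1+c<q refl) _ =
    ∣∩∣≤-cong {p = bridge′ s} refl (cell-joint s c) (bridge′-joint s s c 1+c<q)
  bridge′-cell-far s {c} {i} (inColumn c<q i<len) 1+p<len′ with c ≟ Q
  ... | yes refl = ∣∩∣≤-cong {p = bridge′ s} refl (cell-raised s Q i<len)
    (bridge′-raised-far s i (+-cancelˡ-< (Q * S) (suc i) len (subst (_< len′) (sym (+-suc (Q * S) i)) 1+p<len′)))
  ... | no c≢Q = ∣∩∣≤-cong {p = bridge′ s} refl (cell-raised s c i<len) (bridge′-raised-cross s c i c<q c≢Q)

  bridge′-cell-next : ∀ s {c i} → s < q → Slot c i → 0 < pos c i → ∣ bridge′ s ∩ cell (next s) c i ∣ ≤ suc k
  bridge′-cell-next s {c} _ (atJoint 1+c<q refl) _ =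
    ∣∩∣≤-cong {p = bridge′ s} refl (cell-joint (next s) c) (bridge′-joint s (next s) c 1+c<q)
  bridge′-cell-next s {c} {i} s<q (inColumn c<q i<len) 0<p with c ≟ 0
  ... | yes refl = ∣∩∣≤-cong {p = bridge′ s} refl (cell-raised (next s) 0 i<len) (bridge′-next-far s i 0<p i<len)
  ... | no c≢0 =
    ∣∩∣≤-cong {p = bridge′ s} refl (cell-raised (next s) c i<len) (bridge′-next-cross s c i s<q c<q c≢0)

  len∸1<len : len ∸ 1 < len
  len∸1<len = ≤-reflexive (m+[n∸m]≡n 0<len)

  last-pos : pos Q (len ∸ 1) ≡ len′ ∸ 1
  last-pos = sym (+-∸-assoc (Q * S) 0<len)

  lifted : Necklace r (suc k) (q + n) len′
  lifted = record
    { facet            = facet′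
    ; bridge           = bridge′
    ; ∣facet∣          = λ s t _ t<len′ → ∣cell∣ s (slotOf t t<len′)
    ; facet-adjacent   = λ s t _ 1+t<len′ →
        subst (λ u → ∣ facet′ s t ∩ facet′ s (suc u) ∣ ≡ 2 + k) (pos-decompose t)
          (cell-adjacent s (slotOf t (<-trans (n<1+n t) 1+t<len′))
            (subst (λ u → suc u < len′) (sym (pos-decompose t)) 1+t<len′))
    ; facet-far        = λ s t t' _ t'<len′ 2+t≤t' →
        cell-far s (slotOf t (<-trans (≤-trans (n≤1+n _) 2+t≤t') t'<len′)) (slotOf t' t'<len′)
          (subst₂ (λ u u' → 2 + u ≤ u') (sym (pos-decompose t)) (sym (pos-decompose t')) 2+t≤t')
    ; facet-cross      = λ s s' t t' s<q s'<q s≢s' t<len′ t'<len′ →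
        cell-copies s<q s'<q s≢s' (slotOf t t<len′) (slotOf t' t'<len′)
    ; ∣bridge∣         = λ s _ → ∣bridge′∣ s
    ; bridge-last      = λ s _ → trans
        (∣∩∣-cong {p = bridge′ s} refl
          (trans (facet′-at s last-pos (m<n⇒m<1+n len∸1<len)) (cell-raised s Q len∸1<len)))
        (bridge′-last s)
    ; bridge-first     = λ s s<q →
        trans (∣∩∣-cong {p = bridge′ s} refl (cell-raised (next s) 0 0<len)) (bridge′-first s s<q)
    ; bridge-far-last  = λ s t _ 1+t<len′ →
        bridge′-cell-far s (slotOf t (<-trans (n<1+n t) 1+t<len′))
          (subst (λ u → suc u < len′) (sym (pos-decompose t)) 1+t<len′)
    ; bridge-far-first = λ s t s<q 0<t t<len′ →
        bridge′-cell-next s s<q (slotOf t t<len′) (subst (0 <_) (sym (pos-decompose t)) 0<t)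
    ; bridge-cross     = λ s s' s<q s'<q s≢s' → bridge′-cross s<q s'<q s≢s'
    }

-- Column c zigzags through the complete bipartite graph on two copies of ℤ/m along the edges {x, y}
-- with y − x ∈ {2c, 2c + 1}, so distinct columns share no edge.
module Base (r : ℕ) where
  open Columns r

  m : ℕ
  m = q + q

  κ : ℕ
  κ = Q + Q

  len : ℕ
  len = κ + κ

  ≤1+κ⇒<m : ∀ {x} → x ≤ suc κ → x < m
  ≤1+κ⇒<m {x} x≤1+κ = subst (x <_) (cong suc (sym (+-suc Q Q))) (s≤s x≤1+κ)

  point : ℕ → Subset m
  point x = pt m (x % m)

  ∣point∣ : ∀ x → ∣ point x ∣ ≡ 1
  ∣point∣ x = ∣pt∣≡1 m (m%n<n x m)

  point-≡ : ∀ x y → x % m ≡ y % m → ∣ point x ∩ point y ∣ ≡ 1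
  point-≡ x y eq = trans (cong (λ z → ∣ point x ∩ pt m z ∣) (sym eq)) (∣pt∩pt∣≡1 m (m%n<n x m))

  point-≢ : ∀ x y → x % m ≢ y % m → ∣ point x ∩ point y ∣ ≡ 0
  point-≢ x y = ∣pt∩pt∣≡0 m

  ∣point∩p∣≤1 : ∀ x (p : Subset m) → ∣ point x ∩ p ∣ ≤ 1
  ∣point∩p∣≤1 x = ∣pt∩p∣≤1 (x % m)

  point-offsets : ∀ x {t t'} → t < m → t' < m → t ≢ t' → ∣ point (x + t) ∩ point (x + t') ∣ ≡ 0
  point-offsets x {t} {t'} t<m t'<m t≢t' = point-≢ (x + t) (x + t') (λ eq → t≢t' (+-%-cancelˡ m x eq t<m t'<m))

  origin : ℕ → ℕ
  origin c = (q ∸ c) + (q ∸ c)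

  left : ℕ → ℕ → ℕ
  left c i = origin c + ⌊ suc i /2⌋

  right : ℕ → ℕ → ℕ
  right c i = origin c + (c + c) + suc ⌊ i /2⌋

  edge : ℕ → ℕ → Subset (m + m)
  edge c i = point (left c i) ++ point (right c i)

  junction : ℕ → Subset (m + m)
  junction c = point (origin c + κ) ++ ⊥

  left-offset<m : ∀ {i} → i < len → ⌊ suc i /2⌋ < m
  left-offset<m i<len = ≤1+κ⇒<m (m≤n⇒m≤1+n (n<m+m⇒⌊1+n/2⌋≤m i<len))

  right-offset<m : ∀ {i} → i < len → suc ⌊ i /2⌋ < m
  right-offset<m i<len = ≤1+κ⇒<m (s≤s (<⇒≤ (n<m+m⇒⌊n/2⌋<m i<len)))

  right≡left+gap : ∀ c i → ∃[ b ] (b ≤ 1 × right c i ≡ left c i + (c + c + b))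
  right≡left+gap c i with ⌊1+n/2⌋≡⌊n/2⌋⊎1+⌊n/2⌋ i
  ... | inj₁ eq =
    1 , s≤s z≤n , trans (shift (origin c) ⌊ i /2⌋ (c + c)) (cong (λ h → origin c + h + (c + c + 1)) (sym eq))
    where
    shift : ∀ x h g → x + g + suc h ≡ x + h + (g + 1)
    shift = solve-∀
  ... | inj₂ eq = 0 , z≤n , trans (shift (origin c) ⌊ i /2⌋ (c + c)) (cong (λ h → origin c + h + (c + c + 0)) (sym eq))
    where
    shift : ∀ x h g → x + g + suc h ≡ x + suc h + (g + 0)
    shift = solve-∀

  ∣edge∣ : ∀ c i → c < q → i < len → ∣ edge c i ∣ ≡ 2
  ∣edge∣ c i _ _ =
    trans (∣++∣ (point (left c i)) (point (right c i))) (cong₂ _+_ (∣point∣ (left c i)) (∣point∣ (right c i)))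

  edge-adjacent : ∀ c i → c < q → suc i < len → ∣ edge c i ∩ edge c (suc i) ∣ ≡ 1
  edge-adjacent c i _ 1+i<len with ⌊1+n/2⌋≡⌊n/2⌋⊎1+⌊n/2⌋ i
  ... | inj₁ eq = ∣++∩++∣≡ (point (left c i)) (point (left c (suc i))) (point (right c i)) (point (right c (suc i)))
    (point-offsets (origin c) (left-offset<m i<len) (left-offset<m 1+i<len) (λ eq' → 1+n≢n (trans (sym eq') eq)))
    (point-≡ (right c i) (right c (suc i)) (cong (λ h → (origin c + (c + c) + suc h) % m) (sym eq)))
    where i<len = <-trans (n<1+n i) 1+i<len
  ... | inj₂ eq = ∣++∩++∣≡ (point (left c i)) (point (left c (suc i))) (point (right c i)) (point (right c (suc i)))
    (point-≡ (left c i) (left c (suc i)) (cong (λ h → (origin c + h) % m) eq))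
    (point-offsets (origin c + (c + c)) (right-offset<m i<len) (right-offset<m 1+i<len)
      (λ (eq' : suc ⌊ i /2⌋ ≡ suc ⌊ suc i /2⌋) → 1+n≢n (sym (trans (suc-injective eq') eq))))
    where i<len = <-trans (n<1+n i) 1+i<len

  edge-far : ∀ c i j → c < q → j < len → 2 + i ≤ j → ∣ edge c i ∩ edge c j ∣ ≤ 0
  edge-far c i j _ j<len 2+i≤j =
    ≤-reflexive (∣++∩++∣≡ (point (left c i)) (point (left c j)) (point (right c i)) (point (right c j))
    (point-offsets (origin c) (left-offset<m i<len) (left-offset<m j<len) (<⇒≢ (⌊n/2⌋-mono (s≤s 2+i≤j))))
    (point-offsets (origin c + (c + c)) (right-offset<m i<len) (right-offset<m j<len) (<⇒≢ (s≤s (⌊n/2⌋-mono 2+i≤j)))))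
    where i<len = <-trans (≤-trans (n≤1+n (suc i)) 2+i≤j) j<len

  gap-injective : ∀ {c c' b b'} → c < q → c' < q → b ≤ 1 → b' ≤ 1 →
                  ∀ x → (x + (c + c + b)) % m ≡ (x + (c' + c' + b')) % m → c ≡ c'
  gap-injective {c} {c'} {b} {b'} c<q c'<q b≤1 b'≤1 x eq = begin
    c                    ≡⟨ ⌊n+n+b/2⌋≡n c b≤1 ⟨
    ⌊ c + c + b /2⌋      ≡⟨ cong ⌊_/2⌋ (+-%-cancelˡ m x eq (gap<m c<q b≤1) (gap<m c'<q b'≤1)) ⟩
    ⌊ c' + c' + b' /2⌋   ≡⟨ ⌊n+n+b/2⌋≡n c' b'≤1 ⟩
    c'                   ∎
    where
    open ≡-Reasoning
    gap<m : ∀ {c b} → c < q → b ≤ 1 → c + c + b < m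
    gap<m {c} c<q b≤1 = ≤1+κ⇒<m (≤-trans (+-monoʳ-≤ (c + c) b≤1)
      (≤-trans (≤-reflexive (+-comm (c + c) 1)) (s≤s (+-mono-≤ (≤-pred c<q) (≤-pred c<q)))))

  edge-cross : ∀ c c' i j → c < q → c' < q → c ≢ c' → i < len → j < len → ∣ edge c i ∩ edge c' j ∣ ≤ 1
  edge-cross c c' i j c<q c'<q c≢c' _ _ with left c i % m ≟ left c' j % m
  ... | no lefts≢ = ∣++∩++∣≤ (point (left c i)) (point (left c' j)) (point (right c i)) (point (right c' j))
    (≤-reflexive (point-≢ (left c i) (left c' j) lefts≢)) (∣point∩p∣≤1 (right c i) (point (right c' j)))
  ... | yes lefts≡ = ∣++∩++∣≤ (point (left c i)) (point (left c' j)) (point (right c i)) (point (right c' j))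
    (∣point∩p∣≤1 (left c i) (point (left c' j))) (≤-reflexive (point-≢ (right c i) (right c' j) rights≢))
    where
    rights≢ : right c i % m ≢ right c' j % m
    rights≢ rights≡ with right≡left+gap c i | right≡left+gap c' j
    ... | b , b≤1 , eq | b' , b'≤1 , eq' = c≢c' (gap-injective c<q c'<q b≤1 b'≤1 (left c i) (begin
      (left c i + (c + c + b)) % m      ≡⟨ cong (_% m) eq ⟨
      right c i % m                     ≡⟨ rights≡ ⟩
      right c' j % m                    ≡⟨ cong (_% m) eq' ⟩
      (left c' j + (c' + c' + b')) % m  ≡⟨ %-congˡ-+ m {left c' j} {left c i} (c' + c' + b') (sym lefts≡) ⟩
      (left c i + (c' + c' + b')) % m   ∎))
      where open ≡-Reasoning

  junction-wrap : ∀ {c} → c < q → (origin c + κ) % m ≡ (origin (next c) + 0) % m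
  junction-wrap {c} c<q with suc c <? q
  ... | yes 1+c<q = begin
    (origin c + κ) % m                             ≡⟨ cong (λ x → (x + x + κ) % m) (m∸n≡1+[m∸1+n] c<q) ⟩
    (suc (q ∸ suc c) + suc (q ∸ suc c) + κ) % m   ≡⟨ cong (_% m) (shift (q ∸ suc c) Q) ⟩
    (origin (suc c) + m) % m                       ≡⟨ [m+n]%n≡m%n (origin (suc c)) m ⟩
    origin (suc c) % m                             ≡⟨ cong (_% m) (+-identityʳ (origin (suc c))) ⟨
    (origin (suc c) + 0) % m                       ≡⟨ cong (λ c' → (origin c' + 0) % m) (next-suc 1+c<q) ⟨
    (origin (next c) + 0) % m                      ∎
    where
    open ≡-Reasoning
    shift : ∀ x Q → suc x + suc x + (Q + Q) ≡ x + x + (suc Q + suc Q)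
    shift = solve-∀
  ... | no 1+c≮q = begin
    (origin c + κ) % m            ≡⟨ cong (λ c' → (origin c' + κ) % m) c≡Q ⟩
    (origin Q + κ) % m            ≡⟨ cong (λ x → (x + x + κ) % m) (m+n∸n≡m 1 Q) ⟩
    (1 + 1 + κ) % m              ≡⟨ cong (_% m) (shift Q) ⟩
    (m + 0) % m                  ≡⟨ cong (λ c' → (origin c' + 0) % m) (trans (cong next c≡Q) next-Q) ⟨
    (origin (next c) + 0) % m     ∎
    where
    open ≡-Reasoning
    c≡Q : c ≡ Q
    c≡Q = ≤-antisym (≤-pred c<q) (≤-pred (≮⇒≥ 1+c≮q))
    shift : ∀ Q → 1 + 1 + (Q + Q) ≡ suc Q + suc Q + 0
    shift = solve-∀

  junction-apart : ∀ {c c'} → c < c' → c' < q → (origin c + κ) % m ≢ (origin c' + κ) % m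
  junction-apart {c} {c'} c<c' c'<q eq = <⇒≢ lower (%-injective-window m (sym eq) (<⇒≤ lower) upper)
    where
    open ≤-Reasoning
    lower : origin c' + κ < origin c + κ
    lower = +-monoˡ-< κ (+-mono-< (∸-monoʳ-< c<c' (<⇒≤ c'<q)) (∸-monoʳ-< c<c' (<⇒≤ c'<q)))
    upper : origin c + κ < origin c' + κ + m
    upper = begin-strict
      origin c + κ           ≤⟨ +-monoˡ-≤ κ (+-mono-≤ (m∸n≤m q c) (m∸n≤m q c)) ⟩
      m + κ                 <⟨ +-monoˡ-≤ (m + κ) (≤-trans (m<n⇒0<n∸m c'<q) (m≤m+n (q ∸ c') (q ∸ c'))) ⟩
      origin c' + (m + κ)    ≡⟨ cong (origin c' +_) (+-comm m κ) ⟩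
      origin c' + (κ + m)    ≡⟨ +-assoc (origin c') κ m ⟨
      origin c' + κ + m      ∎

  junction-injective : ∀ {c c'} → c < q → c' < q → c ≢ c' → (origin c + κ) % m ≢ (origin c' + κ) % m
  junction-injective {c} {c'} c<q c'<q c≢c' with <-cmp c c'
  ... | tri< c<c' _ _ = junction-apart c<c' c'<q
  ... | tri≈ _ c≡c' _ = ⊥-elim (c≢c' c≡c')
  ... | tri> _ _ c'<c = junction-apart c'<c c<q ∘ sym

  ∣junction∩edge∣ : ∀ c c' i → ∣ junction c ∩ edge c' i ∣ ≡ ∣ point (origin c + κ) ∩ point (left c' i) ∣
  ∣junction∩edge∣ c c' i = trans (∣++∩++∣ (point (origin c + κ)) (point (left c' i)) ⊥ (point (right c' i)))
    (trans (cong (∣ point (origin c + κ) ∩ point (left c' i) ∣ +_) (∣⊥∩p∣≡0 (point (right c' i)))) (+-identityʳ _))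

  base : Necklace r 0 (m + m) len
  base = record
    { facet            = edge
    ; bridge           = junction
    ; ∣facet∣          = ∣edge∣
    ; facet-adjacent   = edge-adjacent
    ; facet-far        = edge-far
    ; facet-cross      = edge-cross
    ; ∣bridge∣         = λ c _ →
        trans (∣++∣ (point (origin c + κ)) ⊥) (cong₂ _+_ (∣point∣ (origin c + κ)) (∣⊥∣≡0 m))
    ; bridge-last      = λ c _ → trans (∣junction∩edge∣ c c (len ∸ 1))
        (point-≡ (origin c + κ) (left c (len ∸ 1)) (cong (λ h → (origin c + h) % m) (n≡⌊n+n/2⌋ κ)))
    ; bridge-first     = λ c c<q → trans (∣junction∩edge∣ c (next c) 0)
        (point-≡ (origin c + κ) (left (next c) 0) (junction-wrap c<q))
    ; bridge-far-last  = λ c i _ 1+i<len → ≤-reflexive (trans (∣junction∩edge∣ c c i)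
        (point-offsets (origin c) (≤1+κ⇒<m (n≤1+n κ)) (left-offset<m (<-trans (n<1+n i) 1+i<len))
          (≢-sym (<⇒≢ (n<m+m⇒⌊n/2⌋<m 1+i<len)))))
    ; bridge-far-first = λ c j c<q 0<j j<len → ≤-reflexive (trans (∣junction∩edge∣ c (next c) j)
        (point-≢ (origin c + κ) (left (next c) j) λ eq → <⇒≢ (⌊n/2⌋-mono (s≤s 0<j))
          (+-%-cancelˡ m (origin (next c)) (trans (sym (junction-wrap c<q)) eq) (≤1+κ⇒<m z≤n) (left-offset<m j<len))))
    ; bridge-cross     = λ c c' c<q c'<q c≢c' →
        ∣++∩++∣≤ (point (origin c + κ)) (point (origin c' + κ)) ⊥ ⊥
          (≤-reflexive (point-≢ (origin c + κ) (origin c' + κ) (junction-injective c<q c'<q c≢c')))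
          (≤-reflexive (∣⊥∩p∣≡0 (⊥ {m})))
    }

necklace-tower : ∀ r k → ∃[ len ] (Columns.q r ^ suc k ≤ len × Necklace r k ((k + 4) * Columns.q r) len)
necklace-tower r zero = len , q^1≤len , subst (λ n → Necklace r 0 n len) (four-copies q) base
  where
  open Columns r
  open Base r
  four-copies : ∀ x → (x + x) + (x + x) ≡ 4 * x
  four-copies = solve-∀
  q^1≤len : q ^ 1 ≤ len
  q^1≤len = ≤-trans (≤-reflexive (*-identityʳ q)) (≤-trans (s≤s (m≤n+m Q (suc r))) (m≤m+n κ κ))
necklace-tower r (suc k) with necklace-tower r k
... | len , q^1+k≤len , N = Lift.len′ 0<len N , q^2+k≤len′ , Lift.lifted 0<len N
  where
  open Columns r
  0<len : 0 < len
  0<len = ≤-trans (m^n>0 q (suc k)) q^1+k≤len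
  q^2+k≤len′ : q ^ suc (suc k) ≤ Q * suc len + len
  q^2+k≤len′ = begin
    q * q ^ suc k        ≤⟨ *-monoʳ-≤ q q^1+k≤len ⟩
    len + Q * len        ≡⟨ +-comm len (Q * len) ⟩
    Q * len + len        ≤⟨ +-monoˡ-≤ len (*-monoʳ-≤ Q (n≤1+n len)) ⟩
    Q * suc len + len    ∎
    where open ≤-Reasoning

single-facet : ∀ {n} d (X : Subset n) → ∣ X ∣ ≡ d →
               IsPure d (X ∷ []) × StronglyConnected d (X ∷ []) × Diameter d (X ∷ []) 0
single-facet d X ∣X∣≡d = ∣X∣≡d ∷ [] , (λ A B A∈ B∈ → 0 , walk A B A∈ B∈) ,
                         (λ A B A∈ B∈ → 0 , walk A B A∈ B∈ , z≤n) ,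
                         X , X , here refl , here refl , here (here refl) , λ _ _ → z≤n
  where
  walk : ∀ A B → A ∈ X ∷ [] → B ∈ X ∷ [] → Walk d (X ∷ []) A B 0
  walk A B (here refl) (here refl) = here (here refl)

n^1+k≤[D+3][d+2]^1+k : ∀ k q L → q ^ suc k ≤ L →
                       ((k + 4) * q) ^ suc k ≤ (L ∸ 1 + 3) * (suc (suc k) + 2) ^ suc k
n^1+k≤[D+3][d+2]^1+k k q L q^1+k≤L = begin
  ((k + 4) * q) ^ suc k                ≡⟨ [m*n]^k≡m^k*n^k (k + 4) q (suc k) ⟩
  (k + 4) ^ suc k * q ^ suc k          ≤⟨ *-monoʳ-≤ ((k + 4) ^ suc k) (≤-trans q^1+k≤L L≤L∸1+3) ⟩
  (k + 4) ^ suc k * (L ∸ 1 + 3)        ≡⟨ *-comm ((k + 4) ^ suc k) (L ∸ 1 + 3) ⟩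
  (L ∸ 1 + 3) * (k + 4) ^ suc k        ≡⟨ cong (λ x → (L ∸ 1 + 3) * x ^ suc k) k+4≡2+k+2 ⟩
  (L ∸ 1 + 3) * (suc (suc k) + 2) ^ suc k ∎
  where
  open ≤-Reasoning
  k+4≡2+k+2 : k + 4 ≡ suc (suc k) + 2
  k+4≡2+k+2 = trans (+-suc k 3) (cong suc (+-suc k 2))
  L≤L∸1+3 : L ≤ L ∸ 1 + 3
  L≤L∸1+3 = ≤-trans (m≤n+m∸n L 1) (≤-trans (≤-reflexive (+-comm 1 (L ∸ 1))) (+-monoʳ-≤ (L ∸ 1) (s≤s z≤n)))

theorem1p2 : (d : ℕ) → (N : ℕ) →
    ∃[ n ] (N ≤ n ×
    ∃[ C ] (IsPure {n} d C × StronglyConnected d C ×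
    ∃[ D ] (Diameter d C D × n ^ (d ∸ 1) ≤ (D + 3) * (d + 2) ^ (d ∸ 1))))
theorem1p2 zero N =
  let (pure , connected , diameter) = single-facet 0 ⊥ (∣⊥∣≡0 N)
  in N , ≤-refl , _ , pure , connected , 0 , diameter , s≤s z≤n
theorem1p2 (suc zero) N =
  let (pure , connected , diameter) = single-facet 1 (pt (suc N) 0) (∣pt∣≡1 (suc N) (s≤s z≤n))
  in suc N , n≤1+n N , _ , pure , connected , 0 , diameter , s≤s z≤n
theorem1p2 (suc (suc k)) N with necklace-tower N k
... | len , q^1+k≤len , necklace =
  (k + 4) * q , N≤n , C , pure , strongly-connected ,
  len ∸ 1 , diameter 0<len , n^1+k≤[D+3][d+2]^1+k k q len q^1+k≤len
  where
  open Columns N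
  open Necklace necklace
  open InducedPath (facet 0) len (λ i → ∣facet∣ 0 i (s≤s z≤n)) (λ i → facet-adjacent 0 i (s≤s z≤n))
                   (λ i j j<len 2+i≤j → s≤s (facet-far 0 i j (s≤s z≤n) j<len 2+i≤j))
  0<len : 0 < len
  0<len = ≤-trans (m^n>0 q (suc k)) q^1+k≤len
  N≤n : N ≤ (k + 4) * q
  N≤n = ≤-trans (m≤n+m N 3) (≤-trans (m≤m+n q (3 * q)) (*-monoˡ-≤ q (m≤n+m 4 k)))
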